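{- Let $G$ be a finite simple connected closed graph with $n>1$ vertices and diameter $h$. Then \[C_{\mathrm{WS}}\ge \frac13-\frac{h+1}{3n}.\]
   Context: A labeling of $G$ is a bijection $V(G)\to[n]$, identifying $V(G)=[n]$; it is closed if whenever $\{j,i\},\{i,k\}\in E(G)$ with $j\neq k$ and either $j>i<k$ or $j<i>k$, then $\{j,k\}\in E(G)$; $G$ is closed if it has a closed labeling. The local clustering coefficient of a vertex $v$ is $C_v=\frac{\#\{\text{pairs of neighbors of } v \text{ joined by an edge}\}}{\#\{\text{pairs of neighbors of } v\}}$ if $\deg(v)\ge2$, and $C_v=0$ if $\deg(v)\le1$. The Watts–Strogatz clustering coefficient is $C_{\mathrm{WS}}=\frac1n\sum_{v\in V(G)}C_v$. -}

module Defs where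

open import Data.Bool using (Bool; true; false; _∧_; if_then_else_)
open import Data.Nat using (ℕ; zero; suc; _+_; _*_; _<_; _≤_; _≥_)
open import Data.Fin using (Fin; toℕ; _<?_)
open import Data.Fin.Base using () renaming (_<_ to _<ᶠ_; _>_ to _>ᶠ_)
open import Data.List using (List; []; _∷_; length; filter; foldr; allFin; concatMap; map)
open import Data.Product using (Σ; _×_; _,_; ∃; ∃-syntax)
open import Data.Sum using (_⊎_)
open import Data.Integer using (+_)
open import Data.Rational using (ℚ; 0ℚ; _/_; _-_) renaming (_+_ to _+ℚ_; _*_ to _*ℚ_)
open import Relation.Binary.PropositionalEquality using (_≡_; _≢_)
open import Relation.Nullary.Decidable using (⌊_⌋)
open import Function.Definitions using (Bijective)

record Graph (n : ℕ) : Set where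
  field
    adj     : Fin n → Fin n → Bool
    symm    : ∀ u v → adj u v ≡ adj v u
    irrefl  : ∀ u → adj u u ≡ false
open Graph public

Edge : ∀ {n} → Graph n → Fin n → Fin n → Set
Edge G u v = adj G u v ≡ true

data Walk {n : ℕ} (G : Graph n) : Fin n → Fin n → ℕ → Set where
  here : ∀ u → Walk G u u 0
  step : ∀ {u w v ℓ} → Edge G u w → Walk G w v ℓ → Walk G u v (suc ℓ)

DistLe : ∀ {n} → Graph n → Fin n → Fin n → ℕ → Set
DistLe G u v ℓ = ∃[ k ] (k ≤ ℓ × Walk G u v k)

Connected : ∀ {n} → Graph n → Set
Connected G = ∀ u v → ∃[ k ] Walk G u v k

HasDiameter : ∀ {n} → Graph n → ℕ → Set
HasDiameter G h =
  (∀ u v → DistLe G u v h) ×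
  (∃[ u ] ∃[ v ] (∀ k → Walk G u v k → h ≤ k))

ClosedLabeling : ∀ {n} → Graph n → (Fin n → Fin n) → Set
ClosedLabeling G L =
  ∀ j i k → Edge G j i → Edge G i k → j ≢ k →
    ((L j >ᶠ L i × L i <ᶠ L k) ⊎ (L j <ᶠ L i × L i >ᶠ L k)) →
    Edge G j k

IsClosed : ∀ {n} → Graph n → Set
IsClosed G = Σ (_ → _) λ L → Bijective _≡_ _≡_ L × ClosedLabeling G L

count : ∀ {A : Set} → (A → Bool) → List A → ℕ
count p xs = length (filter (λ x → Data.Bool._≟_ (p x) true) xs)
  where import Data.Bool


unorderedPairs : (n : ℕ) → List (Fin n × Fin n)
unorderedPairs n =
  concatMap (λ a → concatMap (λ b → if ⌊ a <? b ⌋ then (a , b) ∷ [] else []) (allFin n)) (allFin n)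

neighbourPairs : ∀ {n} → Graph n → Fin n → ℕ
neighbourPairs {n} G v = count (λ { (a , b) → adj G v a ∧ adj G v b }) (unorderedPairs n)

linkedNeighbourPairs : ∀ {n} → Graph n → Fin n → ℕ
linkedNeighbourPairs {n} G v =
  count (λ { (a , b) → adj G v a ∧ adj G v b ∧ adj G a b }) (unorderedPairs n)

degree : ∀ {n} → Graph n → Fin n → ℕ
degree {n} G v = count (adj G v) (allFin n)

-- local clustering coefficient: 0 if deg ≤ 1, otherwise the ratio
localClustering : ∀ {n} → Graph n → Fin n → ℚ
localClustering G v with degree G v | neighbourPairs G v
... | zero        | _      = 0ℚ
... | suc zero    | _      = 0ℚ
... | suc (suc _) | zero   = 0ℚ   -- impossible: deg ≥ 2 gives at least one pair
... | suc (suc _) | suc p  = (+ linkedNeighbourPairs G v) / suc p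

sumℚ : List ℚ → ℚ
sumℚ = foldr _+ℚ_ 0ℚ

-- Watts–Strogatz clustering coefficient (1/n) Σ_v C_v  (set to 0 for n = 0)
CWS : ∀ {n} → Graph n → ℚ
CWS {zero}  G = 0ℚ
CWS {suc m} G = ((+ 1) / suc m) *ℚ sumℚ (map (localClustering G) (allFin (suc m)))

wsBound : (n h : ℕ) → ℚ
wsBound zero    h = 0ℚ
wsBound (suc m) h = ((+ 1) / 3) - ((+ (h + 1)) / (3 * suc m))

-- Fix a closed labelling ℓ. In a connected closed graph every walk can be straightened,
-- using closedness, into a walk whose labels move monotonically; consequently, if an edge
-- x y straddles a vertex z (ℓ x < ℓ z < ℓ y), then z is adjacent to both x and y. Such a z
-- has neighbours above and below it; same-side neighbour pairs are all joined by
-- closedness, and x y joins one mixed pair, which forces C_z ≥ 1/3. So a vertex with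
-- C_v < 1/3 is never straddled by an edge. Along a walk of length k ≤ h from the vertex
-- of least label to the one of greatest label, each edge (a, c) covers the labels in
-- (ℓ a, ℓ c], where only c itself can have C_c < 1/3. Hence at most h + 1 vertices have
-- C_v < 1/3, and n · C_WS ≥ (n − h − 1)/3.

module Submission where

open import Defs
open import Data.Nat using (ℕ; _<_)
open import Data.Rational using (_≤_)

open import Algebra.Properties.Semiring.Sum as Sum using ()
open import Data.Bool using (Bool; true; false; _∧_; not; if_then_else_)
import Data.Bool as Bool
open import Data.Bool.Properties using (∧-conicalˡ; ∧-conicalʳ)
open import Data.Fin using (Fin; toℕ; fromℕ) renaming (zero to fzero; suc to fsuc; _<?_ to _<ᶠ?_)
open import Data.Fin.Properties using (toℕ-injective; toℕ-fromℕ; toℕ≤pred[n]; <⇒≢) renaming (_≟_ to _≟ᶠ_)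
import Data.Integer as ℤ
open import Data.Integer.Properties using (pos-+; pos-*)
open import Data.List using (List; []; _∷_; _++_; length; filter; map; allFin; tabulate; concatMap)
open import Data.List.Properties using (filter-++; length-++)
open import Data.Nat using (zero; suc; _+_; _*_; z≤n; s≤s) renaming (_≤_ to _≤ₙ_)
open import Data.Nat.Properties as ℕₚ using (+-*-semiring; <-cmp; <-trans; <-asym; _<?_; _≤?_)
open import Data.Nat.Tactic.RingSolver using (solve-∀)
open import Data.Product using (_×_; _,_; proj₁; proj₂; ∃₂)
open import Data.Rational as ℚ using (ℚ; 0ℚ; _/_; toℚᵘ)
open import Data.Rational.Properties as ℚₚ
  using (toℚᵘ-fromℚᵘ; toℚᵘ-cancel-≤; toℚᵘ-mono-≤; toℚᵘ-homo-+; toℚᵘ-homo-*)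
open import Data.Rational.Unnormalised as ℚᵘ using (*≤*) renaming (_/_ to _/ᵘ_; _≤_ to _≤ᵘ_; _≃_ to _≃ᵘ_)
import Data.Rational.Unnormalised.Properties as ℚᵘₚ
open import Data.Sum using (_⊎_; inj₁; inj₂; swap)
open import Function using (id; _∘_; flip)
open import Function.Definitions using (Injective; Surjective)
open import Relation.Binary using (tri<; tri≈; tri>)
open import Relation.Binary.PropositionalEquality
open import Relation.Nullary using (¬_; Dec; does; yes; no; contradiction)
open import Relation.Nullary.Decidable using (_×-dec_; ⌊_⌋; isYes≗does; dec-true; dec-false)

open Sum +-*-semiring using (sum; sum-cong-≗; ∑-distrib-+; *-distribˡ-sum; *-distribʳ-sum; sum-replicate-zero)

𝟙 : Bool → ℕ
𝟙 true  = 1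
𝟙 false = 0

does⇒ : ∀ {A : Set} (a? : Dec A) → does a? ≡ true → A
does⇒ (yes a) _ = a

𝟙-∧ : ∀ x y → 𝟙 (x ∧ y) ≡ 𝟙 x * 𝟙 y
𝟙-∧ true  y = sym (ℕₚ.+-identityʳ (𝟙 y))
𝟙-∧ false y = refl

𝟙-idem : ∀ x → 𝟙 x * 𝟙 x ≡ 𝟙 x
𝟙-idem true  = refl
𝟙-idem false = refl

𝟙-not : ∀ x → 𝟙 x + 𝟙 (not x) ≡ 1
𝟙-not true  = refl
𝟙-not false = refl

𝟙≤1 : ∀ x → 𝟙 x ≤ₙ 1
𝟙≤1 true  = ℕₚ.≤-refl
𝟙≤1 false = z≤n

𝟙-pair-≤ : ∀ x y z → (x ≡ true → y ≡ true → z ≡ true) → 𝟙 x * 𝟙 y ≤ₙ 𝟙 x * 𝟙 y * 𝟙 z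
𝟙-pair-≤ true  true  z x∧y⇒z rewrite x∧y⇒z refl refl = ℕₚ.≤-refl
𝟙-pair-≤ true  false z _ = z≤n
𝟙-pair-≤ false y     z _ = z≤n

𝟙*𝟙≤1 : ∀ x y → 𝟙 x * 𝟙 y ≤ₙ 1
𝟙*𝟙≤1 true  y = ℕₚ.≤-trans (ℕₚ.≤-reflexive (ℕₚ.+-identityʳ (𝟙 y))) (𝟙≤1 y)
𝟙*𝟙≤1 false y = z≤n

𝟙-does-mono : ∀ {A B : Set} (a? : Dec A) (b? : Dec B) → (A → B) → 𝟙 (does a?) ≤ₙ 𝟙 (does b?)
𝟙-does-mono (yes _) (yes _) _   = ℕₚ.≤-refl
𝟙-does-mono (yes a) (no ¬b) a→b = contradiction (a→b a) ¬b
𝟙-does-mono (no _)  _       _   = z≤n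

𝟙*-≤ : ∀ x {m n} → (x ≡ true → m ≤ₙ n) → 𝟙 x * m ≤ₙ 𝟙 x * n
𝟙*-≤ true  m≤n = ℕₚ.*-monoʳ-≤ 1 (m≤n refl)
𝟙*-≤ false _   = z≤n

sum-mono-≤ : ∀ {n} {f g : Fin n → ℕ} → (∀ i → f i ≤ₙ g i) → sum f ≤ₙ sum g
sum-mono-≤ {zero}  f≤g = z≤n
sum-mono-≤ {suc n} f≤g = ℕₚ.+-mono-≤ (f≤g fzero) (sum-mono-≤ (f≤g ∘ fsuc))

term≤sum : ∀ {n} (f : Fin n → ℕ) i → f i ≤ₙ sum f
term≤sum f fzero    = ℕₚ.m≤m+n (f fzero) _
term≤sum f (fsuc i) = ℕₚ.≤-trans (term≤sum (f ∘ fsuc) i) (ℕₚ.m≤n+m _ (f fzero))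

sum-const-1 : ∀ n → sum {n} (λ _ → 1) ≡ n
sum-const-1 zero    = refl
sum-const-1 (suc n) = cong suc (sum-const-1 n)

sum-𝟙+sum-𝟙-not : ∀ {n} (p : Fin n → Bool) → sum (𝟙 ∘ p) + sum (𝟙 ∘ not ∘ p) ≡ n
sum-𝟙+sum-𝟙-not {n} p =
  trans (sym (∑-distrib-+ (𝟙 ∘ p) (𝟙 ∘ not ∘ p))) (trans (sum-cong-≗ (𝟙-not ∘ p)) (sum-const-1 n))

sum-𝟙-≟ : ∀ {n} (c : Fin n) → sum (λ i → 𝟙 (does (i ≟ᶠ c))) ≡ 1
sum-𝟙-≟ {suc n} fzero    = cong suc (sum-replicate-zero n)
sum-𝟙-≟ {suc n} (fsuc c) = sum-𝟙-≟ c

∑∑-product : ∀ {n} (f g : Fin n → ℕ) → sum (λ a → sum (λ b → f a * g b)) ≡ sum f * sum g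
∑∑-product f g = begin
  sum (λ a → sum (λ b → f a * g b)) ≡⟨ sum-cong-≗ (λ a → sym (*-distribˡ-sum (f a) g)) ⟩
  sum (λ a → f a * sum g)            ≡⟨ sym (*-distribʳ-sum (sum g) f) ⟩
  sum f * sum g                       ∎
  where open ≡-Reasoning

-- Counting pairs of vertices

count-∷ : ∀ {A : Set} (p : A → Bool) x xs → count p (x ∷ xs) ≡ 𝟙 (p x) + count p xs
count-∷ p x xs with p x
... | true  = refl
... | false = refl

count-++ : ∀ {A : Set} (p : A → Bool) xs ys → count p (xs ++ ys) ≡ count p xs + count p ys
count-++ p xs ys =
  trans (cong length (filter-++ (λ x → p x Bool.≟ true) xs ys)) (length-++ (filter (λ x → p x Bool.≟ true) xs))

count-tabulate : ∀ {A : Set} {n} (p : A → Bool) (f : Fin n → A) →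
                 count p (tabulate f) ≡ sum (𝟙 ∘ p ∘ f)
count-tabulate {n = zero}  p f = refl
count-tabulate {n = suc n} p f =
  trans (count-∷ p (f fzero) _) (cong (𝟙 (p (f fzero)) +_) (count-tabulate p (f ∘ fsuc)))

count-concatMap-tabulate : ∀ {A B : Set} {n} (p : B → Bool) (f : A → List B) (g : Fin n → A) →
                           count p (concatMap f (tabulate g)) ≡ sum (count p ∘ f ∘ g)
count-concatMap-tabulate {n = zero}  p f g = refl
count-concatMap-tabulate {n = suc n} p f g =
  trans (count-++ p (f (g fzero)) _) (cong (count p (f (g fzero)) +_) (count-concatMap-tabulate p f (g ∘ fsuc)))

count-if : ∀ {A : Set} (p : A → Bool) c x → count p (if c then x ∷ [] else []) ≡ 𝟙 c * 𝟙 (p x)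
count-if p true  x = count-∷ p x []
count-if p false x = refl

-- Uses does where Defs uses ⌊_⌋ (isYes), because only does reduces on fsuc a <ᶠ? fsuc b.
strictlyUpper : ∀ {n} → (Fin n → Fin n → ℕ) → Fin n → Fin n → ℕ
strictlyUpper f a b = 𝟙 (does (a <ᶠ? b)) * f a b

∑< : ∀ {n} → (Fin n → Fin n → ℕ) → ℕ
∑< f = sum (λ a → sum (strictlyUpper f a))

∑<-cong : ∀ {n} {f g : Fin n → Fin n → ℕ} → (∀ a b → f a b ≡ g a b) → ∑< f ≡ ∑< g
∑<-cong f≡g = sum-cong-≗ λ a → sum-cong-≗ λ b → cong (𝟙 (does (a <ᶠ? b)) *_) (f≡g a b)

∑<-distrib-+ : ∀ {n} (f g : Fin n → Fin n → ℕ) → ∑< (λ a b → f a b + g a b) ≡ ∑< f + ∑< g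
∑<-distrib-+ f g =
  trans (sum-cong-≗ λ a → trans (sum-cong-≗ λ b → ℕₚ.*-distribˡ-+ (𝟙 (does (a <ᶠ? b))) (f a b) (g a b))
                                 (∑-distrib-+ (strictlyUpper f a) (strictlyUpper g a)))
        (∑-distrib-+ (λ a → sum (strictlyUpper f a)) (λ a → sum (strictlyUpper g a)))

∑<-mono-≤ : ∀ {n} {f g : Fin n → Fin n → ℕ} → (∀ {a b} → a ≢ b → f a b ≤ₙ g a b) → ∑< f ≤ₙ ∑< g
∑<-mono-≤ f≤g = sum-mono-≤ λ a → sum-mono-≤ λ b →
  𝟙*-≤ (does (a <ᶠ? b)) λ a<b → f≤g (<⇒≢ (does⇒ (a <ᶠ? b) a<b))

count-unorderedPairs : ∀ n (q : Fin n × Fin n → Bool) →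
                       count q (unorderedPairs n) ≡ ∑< (λ a b → 𝟙 (q (a , b)))
count-unorderedPairs n q =
  trans (count-concatMap-tabulate q row id)
        (sum-cong-≗ λ a → trans (count-concatMap-tabulate q (entry a) id)
                                (sum-cong-≗ λ b → trans (count-if q ⌊ a <ᶠ? b ⌋ (a , b))
                                                          (cong (λ c → 𝟙 c * 𝟙 (q (a , b))) (isYes≗does (a <ᶠ? b)))))
  where
  entry : Fin n → Fin n → List (Fin n × Fin n)
  entry a b = if ⌊ a <ᶠ? b ⌋ then (a , b) ∷ [] else []
  row : Fin n → List (Fin n × Fin n)
  row a = concatMap (entry a) (allFin n)

∑<-symmetrise : ∀ {n} (f : Fin n → Fin n → ℕ) →
                ∑< (λ a b → f a b + f b a) + sum (λ a → f a a) ≡ sum (λ a → sum (f a))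
∑<-symmetrise {zero}  f = refl
∑<-symmetrise {suc n} f = begin
  (sum (λ b → (p b + q b) + 0) + X) + (f₀₀ + D) ≡⟨ cong (λ s → (s + X) + (f₀₀ + D)) (sum-cong-≗ λ b → ℕₚ.+-identityʳ (p b + q b)) ⟩
  (sum (λ b → p b + q b) + X) + (f₀₀ + D)       ≡⟨ cong (λ s → (s + X) + (f₀₀ + D)) (∑-distrib-+ p q) ⟩
  ((sum p + sum q) + X) + (f₀₀ + D)             ≡⟨ regroup (sum p) (sum q) X f₀₀ D ⟩
  (f₀₀ + sum p) + (sum q + (X + D))             ≡⟨ cong (λ s → (f₀₀ + sum p) + (sum q + s)) (∑<-symmetrise f′) ⟩
  (f₀₀ + sum p) + (sum q + sum (λ a → sum (f′ a)))
                                                ≡⟨ cong ((f₀₀ + sum p) +_) (∑-distrib-+ q _) ⟨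
  sum (λ a → sum (f a))                         ∎
  where
  open ≡-Reasoning
  f′ : Fin n → Fin n → ℕ
  f′ a b = f (fsuc a) (fsuc b)
  f₀₀ : ℕ
  f₀₀ = f fzero fzero
  p q : Fin n → ℕ
  p b = f fzero (fsuc b)
  q b = f (fsuc b) fzero
  X D : ℕ
  X = ∑< (λ a b → f′ a b + f′ b a)
  D = sum (λ a → f′ a a)
  regroup : ∀ P Q X f₀₀ D → ((P + Q) + X) + (f₀₀ + D) ≡ (f₀₀ + P) + (Q + (X + D))
  regroup = solve-∀

∑<-product : ∀ {n} (f g : Fin n → ℕ) →
             ∑< (λ a b → f a * g b + g a * f b) + sum (λ a → f a * g a) ≡ sum f * sum g
∑<-product f g = begin
  ∑< (λ a b → f a * g b + g a * f b) + sum (λ a → f a * g a)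
    ≡⟨ cong (λ s → s + sum (λ a → f a * g a)) (∑<-cong λ a b → cong (f a * g b +_) (ℕₚ.*-comm (g a) (f b))) ⟩
  ∑< (λ a b → f a * g b + f b * g a) + sum (λ a → f a * g a)
    ≡⟨ ∑<-symmetrise (λ a b → f a * g b) ⟩
  sum (λ a → sum (λ b → f a * g b))
    ≡⟨ ∑∑-product f g ⟩
  sum f * sum g ∎
  where open ≡-Reasoning

∑<-𝟙-pairs : ∀ {n} (p : Fin n → Bool) →
  let P = ∑< (λ a b → 𝟙 (p a) * 𝟙 (p b)) in P + P + sum (𝟙 ∘ p) ≡ sum (𝟙 ∘ p) * sum (𝟙 ∘ p)
∑<-𝟙-pairs p = begin
  ∑< (λ a b → 𝟙 (p a) * 𝟙 (p b)) + ∑< (λ a b → 𝟙 (p a) * 𝟙 (p b)) + sum (𝟙 ∘ p)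
    ≡⟨ cong₂ _+_ (∑<-distrib-+ pp pp) (sum-cong-≗ (𝟙-idem ∘ p)) ⟨
  ∑< (λ a b → 𝟙 (p a) * 𝟙 (p b) + 𝟙 (p a) * 𝟙 (p b)) + sum (λ a → 𝟙 (p a) * 𝟙 (p a))
    ≡⟨ ∑<-product (𝟙 ∘ p) (𝟙 ∘ p) ⟩
  sum (𝟙 ∘ p) * sum (𝟙 ∘ p) ∎
  where
  open ≡-Reasoning
  pp : Fin _ → Fin _ → ℕ
  pp a b = 𝟙 (p a) * 𝟙 (p b)

∑<-disjoint-product : ∀ {n} (f g : Fin n → ℕ) → (∀ a → f a * g a ≡ 0) →
                      ∑< (λ a b → f a * g b + g a * f b) ≡ sum f * sum g
∑<-disjoint-product {n} f g disjoint = begin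
  mixed                              ≡⟨ ℕₚ.+-identityʳ mixed ⟨
  mixed + 0                          ≡⟨ cong (mixed +_) (sum-replicate-zero n) ⟨
  mixed + sum {n} (λ _ → 0)              ≡⟨ cong (mixed +_) (sum-cong-≗ disjoint) ⟨
  mixed + sum (λ a → f a * g a)      ≡⟨ ∑<-product f g ⟩
  sum f * sum g                      ∎
  where
  open ≡-Reasoning
  mixed : ℕ
  mixed = ∑< (λ a b → f a * g b + g a * f b)

∑<-symmetrised-≥-entry : ∀ {n} (f : Fin n → Fin n → ℕ) → (∀ a → f a a ≡ 0) →
                         ∀ a b → f a b ≤ₙ ∑< (λ a b → f a b + f b a)
∑<-symmetrised-≥-entry {n} f f-diag≡0 a b = begin
  f a b                                                  ≤⟨ term≤sum (f a) b ⟩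
  sum (f a)                                              ≤⟨ term≤sum (λ a → sum (f a)) a ⟩
  sum (λ a → sum (f a))                                  ≡⟨ ∑<-symmetrise f ⟨
  ∑< (λ a b → f a b + f b a) + sum (λ a → f a a)         ≡⟨ cong (∑< (λ a b → f a b + f b a) +_) diagonal≡0 ⟩
  ∑< (λ a b → f a b + f b a) + 0                         ≡⟨ ℕₚ.+-identityʳ _ ⟩
  ∑< (λ a b → f a b + f b a)                             ∎
  where
  open ℕₚ.≤-Reasoning
  diagonal≡0 : sum (λ a → f a a) ≡ 0
  diagonal≡0 = trans (sum-cong-≗ f-diag≡0) (sum-replicate-zero n)

m*n≤m*m+n*n : ∀ m n → m * n ≤ₙ m * m + n * n
m*n≤m*m+n*n m n with ℕₚ.≤-total m n
... | inj₁ m≤n = ℕₚ.≤-trans (ℕₚ.*-monoˡ-≤ n m≤n) (ℕₚ.m≤n+m (n * n) (m * m))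
... | inj₂ n≤m = ℕₚ.≤-trans (ℕₚ.*-monoʳ-≤ m n≤m) (ℕₚ.m≤m+n (m * m) (n * n))

-- U = C(A,2) and D = C(B,2) count the same-side pairs among A + B neighbours.
pair-count-bound : ∀ {A B U D M} → 1 ≤ₙ A → 1 ≤ₙ B → 1 ≤ₙ M →
  U + U + A ≡ A * A → D + D + B ≡ B * B → U + D + A * B ≤ₙ 3 * (U + D + M)
pair-count-bound {suc a} {suc b} {U} {D} {M} _ _ 1≤M 2U+A≡A² 2D+B≡B² = begin
  U + D + suc a * suc b                           ≡⟨ cong (U + D +_) (expand a b) ⟩
  U + D + ((a + b) + (a * b + 1))                 ≤⟨ ℕₚ.+-monoʳ-≤ (U + D) (ℕₚ.+-monoʳ-≤ (a + b) ab+1≤) ⟩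
  U + D + ((a + b) + ((a * a + b * b) + 3 * M))  ≡⟨ cong (U + D +_) (regroup a b (3 * M)) ⟩
  U + D + ((a + a * a) + (b + b * b) + 3 * M)     ≡⟨ cong₂ (λ x y → U + D + (x + y + 3 * M)) (halve U a 2U+A≡A²) (halve D b 2D+B≡B²) ⟩
  U + D + ((U + U) + (D + D) + 3 * M)             ≡⟨ collect U D M ⟩
  3 * (U + D + M)                                 ∎
  where
  open ℕₚ.≤-Reasoning
  expand : ∀ a b → suc a * suc b ≡ (a + b) + (a * b + 1)
  expand = solve-∀
  regroup : ∀ a b m → (a + b) + ((a * a + b * b) + m) ≡ (a + a * a) + (b + b * b) + m
  regroup = solve-∀
  collect : ∀ U D M → U + D + ((U + U) + (D + D) + 3 * M) ≡ 3 * (U + D + M)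
  collect = solve-∀
  ab+1≤ : a * b + 1 ≤ₙ (a * a + b * b) + 3 * M
  ab+1≤ = ℕₚ.+-mono-≤ (m*n≤m*m+n*n a b) (ℕₚ.≤-trans 1≤M (ℕₚ.m≤n*m M 3))
  halve : ∀ C c → C + C + suc c ≡ suc c * suc c → c + c * c ≡ C + C
  halve C c eq = ℕₚ.+-cancelʳ-≡ (suc c) (c + c * c) (C + C) (trans (square c) (sym eq))
    where
    square : ∀ c → c + c * c + suc c ≡ suc c * suc c
    square = solve-∀

-- ℤ's +_ is opened only in this block: elsewhere it would clash with sections such as (x +_).
module _ where

  open ℤ using (+_; +≤+)

  toℚᵘ-/ : ∀ a b → toℚᵘ (+ a / suc b) ≃ᵘ + a /ᵘ suc b
  toℚᵘ-/ a b = toℚᵘ-fromℚᵘ (+ a /ᵘ suc b)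

  /ᵘ-mono-≤ : ∀ {a b c d} → a * suc d ≤ₙ c * suc b → + a /ᵘ suc b ≤ᵘ + c /ᵘ suc d
  /ᵘ-mono-≤ {a} {b} {c} {d} ad≤cb = *≤* (subst₂ ℤ._≤_ (pos-* a (suc d)) (pos-* c (suc b)) (+≤+ ad≤cb))

  /-mono-≤ : ∀ {a b c d} → a * suc d ≤ₙ c * suc b → + a / suc b ≤ + c / suc d
  /-mono-≤ {a} {b} {c} {d} ad≤cb =
    toℚᵘ-cancel-≤ (ℚᵘₚ.≤-respˡ-≃ (ℚᵘₚ.≃-sym (toℚᵘ-/ a b))
                  (ℚᵘₚ.≤-respʳ-≃ (ℚᵘₚ.≃-sym (toℚᵘ-/ c d)) (/ᵘ-mono-≤ ad≤cb)))

  /ᵘ-+ : ∀ a b c d → + a /ᵘ suc b ℚᵘ.+ + c /ᵘ suc d ≡ + (a * suc d + c * suc b) /ᵘ (suc b * suc d)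
  /ᵘ-+ a b c d = cong (_/ᵘ (suc b * suc d))
    (sym (trans (pos-+ (a * suc d) (c * suc b)) (cong₂ ℤ._+_ (pos-* a (suc d)) (pos-* c (suc b)))))

  /ᵘ-* : ∀ a b c d → (+ a /ᵘ suc b) ℚᵘ.* (+ c /ᵘ suc d) ≡ + (a * c) /ᵘ (suc b * suc d)
  /ᵘ-* a b c d = cong (_/ᵘ (suc b * suc d)) (sym (pos-* a c))

  localClustering-nonNeg : ∀ {n} (G : Graph n) v → 0ℚ ≤ localClustering G v
  localClustering-nonNeg G v with degree G v | neighbourPairs G v
  ... | zero        | _     = ℚₚ.≤-refl
  ... | suc zero    | _     = ℚₚ.≤-refl
  ... | suc (suc _) | zero  = ℚₚ.≤-refl
  ... | suc (suc _) | suc p = /-mono-≤ {0} {0} {linkedNeighbourPairs G v} {p} z≤n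

  atLeastThird : ∀ {n} → Graph n → Fin n → Bool
  atLeastThird G v = does (+ 1 / 3 ℚₚ.≤? localClustering G v)

  third≤localClustering : ∀ {n} (G : Graph n) v → 2 ≤ₙ degree G v → 1 ≤ₙ neighbourPairs G v →
    neighbourPairs G v ≤ₙ 3 * linkedNeighbourPairs G v → + 1 / 3 ≤ localClustering G v
  third≤localClustering G v 2≤degree 1≤pairs pairs≤3*linked with degree G v | neighbourPairs G v
  third≤localClustering G v () _ _ | zero | _
  third≤localClustering G v (s≤s ()) _ _ | suc zero | _
  third≤localClustering G v _ () _ | suc (suc _) | zero
  third≤localClustering G v _ _ pairs≤3*linked | suc (suc _) | suc p =
    /-mono-≤ {1} {2} {linkedNeighbourPairs G v} {p}
      (ℕₚ.≤-trans (ℕₚ.≤-reflexive (ℕₚ.*-identityˡ (suc p)))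
                  (ℕₚ.≤-trans pairs≤3*linked (ℕₚ.≤-reflexive (ℕₚ.*-comm 3 (linkedNeighbourPairs G v)))))

  atLeastThird-intro : ∀ {n} (G : Graph n) v → 2 ≤ₙ degree G v → 1 ≤ₙ neighbourPairs G v →
    neighbourPairs G v ≤ₙ 3 * linkedNeighbourPairs G v → atLeastThird G v ≡ true
  atLeastThird-intro G v 2≤degree 1≤pairs pairs≤3*linked =
    dec-true (+ 1 / 3 ℚₚ.≤? localClustering G v) (third≤localClustering G v 2≤degree 1≤pairs pairs≤3*linked)

  third-𝟙≤ : ∀ (q : ℚ) → 0ℚ ≤ q → (third≤q? : Dec (+ 1 / 3 ≤ q)) → + 𝟙 (does third≤q?) /ᵘ 3 ≤ᵘ toℚᵘ q
  third-𝟙≤ q _   (yes third≤q) = ℚᵘₚ.≤-respˡ-≃ (toℚᵘ-/ 1 2) (toℚᵘ-mono-≤ third≤q)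
  third-𝟙≤ q 0≤q (no _)        = ℚᵘₚ.≤-trans (/ᵘ-mono-≤ {0} {2} {0} {0} z≤n) (toℚᵘ-mono-≤ 0≤q)

  sumℚ-≥-third : ∀ {A : Set} (c : A → ℚ) → (∀ x → 0ℚ ≤ c x) → ∀ {k} (g : Fin k → A) →
    + sum (λ i → 𝟙 (does (+ 1 / 3 ℚₚ.≤? c (g i)))) /ᵘ 3 ≤ᵘ toℚᵘ (sumℚ (map c (tabulate g)))
  sumℚ-≥-third c c≥0 {zero}  g = /ᵘ-mono-≤ z≤n
  sumℚ-≥-third c c≥0 {suc k} g = begin
    + (i + r) /ᵘ 3                               ≤⟨ /ᵘ-mono-≤ (ℕₚ.≤-reflexive (spread i r)) ⟩
    + (i * 3 + r * 3) /ᵘ (3 * 3)                 ≡⟨ /ᵘ-+ i 2 r 2 ⟨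
    + i /ᵘ 3 ℚᵘ.+ + r /ᵘ 3                       ≤⟨ ℚᵘₚ.+-mono-≤ (third-𝟙≤ (c (g fzero)) (c≥0 (g fzero)) (+ 1 / 3 ℚₚ.≤? c (g fzero)))
                                                                 (sumℚ-≥-third c c≥0 (g ∘ fsuc)) ⟩
    toℚᵘ (c (g fzero)) ℚᵘ.+ toℚᵘ rest           ≃⟨ toℚᵘ-homo-+ (c (g fzero)) rest ⟨
    toℚᵘ (c (g fzero) ℚ.+ rest)                  ∎
    where
    open ℚᵘₚ.≤-Reasoning
    i r : ℕ
    i = 𝟙 (does (+ 1 / 3 ℚₚ.≤? c (g fzero)))
    r = sum (λ j → 𝟙 (does (+ 1 / 3 ℚₚ.≤? c (g (fsuc j)))))
    rest : ℚ
    rest = sumℚ (map c (tabulate (g ∘ fsuc)))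
    spread : ∀ i r → (i + r) * suc (2 + 2 * 3) ≡ (i * 3 + r * 3) * 3
    spread = solve-∀

  1/3≤g/3n+[h+1]/3n : ∀ m g h → suc m ≤ₙ g + suc h →
    + 1 /ᵘ 3 ≤ᵘ (+ 1 /ᵘ suc m) ℚᵘ.* (+ g /ᵘ 3) ℚᵘ.+ + (h + 1) /ᵘ (3 * suc m)
  1/3≤g/3n+[h+1]/3n m g h n≤g+h+1 =
    subst (+ 1 /ᵘ 3 ≤ᵘ_) (sym (trans (cong (ℚᵘ._+ (+ (h + 1) /ᵘ (3 * suc m))) (/ᵘ-* 1 m g 2)) (/ᵘ-+ (1 * g) _ (h + 1) _)))
          (/ᵘ-mono-≤ (begin
            1 * (suc m * 3 * (3 * suc m))                               ≡⟨ square m ⟩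
            (3 * suc m) * (3 * suc m)                                   ≤⟨ ℕₚ.*-monoʳ-≤ (3 * suc m) (ℕₚ.*-monoʳ-≤ 3 n≤g+h+1) ⟩
            (3 * suc m) * (3 * (g + suc h))                             ≡⟨ expand m g h ⟩
            (1 * g * (3 * suc m) + (h + 1) * (suc m * 3)) * 3           ∎))
    where
    open ℕₚ.≤-Reasoning
    square : ∀ m → 1 * (suc m * 3 * (3 * suc m)) ≡ (3 * suc m) * (3 * suc m)
    square = solve-∀
    expand : ∀ m g h → (3 * suc m) * (3 * (g + suc h)) ≡ (1 * g * (3 * suc m) + (h + 1) * (suc m * 3)) * 3
    expand = solve-∀

  p≤q+r⇒p-r≤q : ∀ {p q r : ℚ} → p ≤ q ℚ.+ r → p ℚ.- r ≤ q
  p≤q+r⇒p-r≤q {p} {q} {r} p≤q+r = subst (p ℚ.- r ≤_) q+r-r≡q (ℚₚ.+-monoˡ-≤ (ℚ.- r) p≤q+r)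
    where
    q+r-r≡q : q ℚ.+ r ℚ.- r ≡ q
    q+r-r≡q = trans (ℚₚ.+-assoc q r (ℚ.- r)) (trans (cong (q ℚ.+_) (ℚₚ.+-inverseʳ r)) (ℚₚ.+-identityʳ q))

  wsBound≤ : ∀ m h g (S : ℚ) → suc m ≤ₙ g + suc h → + g /ᵘ 3 ≤ᵘ toℚᵘ S → wsBound (suc m) h ≤ (+ 1 / suc m) ℚ.* S
  wsBound≤ m h g S n≤g+h+1 g/3≤S = p≤q+r⇒p-r≤q (toℚᵘ-cancel-≤ (begin
    toℚᵘ (+ 1 / 3)                                                 ≃⟨ toℚᵘ-/ 1 2 ⟩
    + 1 /ᵘ 3                                                       ≤⟨ 1/3≤g/3n+[h+1]/3n m g h n≤g+h+1 ⟩
    (+ 1 /ᵘ suc m) ℚᵘ.* (+ g /ᵘ 3) ℚᵘ.+ + (h + 1) /ᵘ (3 * suc m)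
      ≤⟨ ℚᵘₚ.+-monoˡ-≤ (+ (h + 1) /ᵘ (3 * suc m)) (ℚᵘₚ.*-monoʳ-≤-nonNeg (+ 1 /ᵘ suc m) g/3≤S) ⟩
    (+ 1 /ᵘ suc m) ℚᵘ.* toℚᵘ S ℚᵘ.+ + (h + 1) /ᵘ (3 * suc m)
      ≃⟨ ℚᵘₚ.+-cong (ℚᵘₚ.*-congʳ (toℚᵘ-/ 1 m)) (toℚᵘ-/ (h + 1) _) ⟨
    toℚᵘ (+ 1 / suc m) ℚᵘ.* toℚᵘ S ℚᵘ.+ toℚᵘ (+ (h + 1) / (3 * suc m))
      ≃⟨ ℚᵘₚ.+-congˡ (toℚᵘ (+ (h + 1) / (3 * suc m))) (toℚᵘ-homo-* (+ 1 / suc m) S) ⟨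
    toℚᵘ ((+ 1 / suc m) ℚ.* S) ℚᵘ.+ toℚᵘ (+ (h + 1) / (3 * suc m))
      ≃⟨ toℚᵘ-homo-+ ((+ 1 / suc m) ℚ.* S) (+ (h + 1) / (3 * suc m)) ⟨
    toℚᵘ ((+ 1 / suc m) ℚ.* S ℚ.+ + (h + 1) / (3 * suc m))          ∎))
    where open ℚᵘₚ.≤-Reasoning

-- Monotone chains in closed graphs

module Chains {n} (G : Graph n) where

  Edge-sym : ∀ {u v} → Edge G u v → Edge G v u
  Edge-sym {u} {v} e = trans (symm G v u) e

  Edge⇒≢ : ∀ {u v} → Edge G u v → u ≢ v
  Edge⇒≢ {u} e refl with trans (sym (irrefl G u)) e
  ... | ()

  data Chain (R : Fin n → Fin n → Set) : Fin n → Fin n → Set where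
    [] : ∀ {a} → Chain R a a
    _∷_ : ∀ {a w b} → Edge G a w × R a w → Chain R w b → Chain R a b

  module MonotoneChains
    (R : Fin n → Fin n → Set)
    (R-trans : ∀ {a b c} → R a b → R b c → R a c)
    (R-asym : ∀ {a b} → R a b → ¬ R b a)
    (R-connex : ∀ {a b} → a ≢ b → R a b ⊎ R b a)
    (R-closed : ∀ {a p q} → Edge G a p → Edge G p q → a ≢ q → R p a → R p q → Edge G a q)
    (R-closed˘ : ∀ {a p q} → Edge G a p → Edge G p q → a ≢ q → R a p → R q p → Edge G a q)
    where

    Chain-trans : ∀ {a b} → Chain R a b → a ≡ b ⊎ R a b
    Chain-trans []                = inj₁ refl
    Chain-trans ((_ , r) ∷ chain) with Chain-trans chain
    ... | inj₁ refl = inj₂ r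
    ... | inj₂ r′   = inj₂ (R-trans r r′)

    ¬Chain-against : ∀ {a b} → Chain R a b → ¬ R b a
    ¬Chain-against chain rba with Chain-trans chain
    ... | inj₁ refl = R-asym rba rba
    ... | inj₂ rab  = R-asym rab rba

    -- If p is R-below both a and its successor q, closedness joins a to q directly.
    Edge-∷-Chain : ∀ {a p b} → Edge G a p → Chain R p b → Chain R a b ⊎ Chain (flip R) a b
    Edge-∷-Chain {a} {p} e chain with R-connex (Edge⇒≢ e)
    ... | inj₁ rap = inj₁ ((e , rap) ∷ chain)
    Edge-∷-Chain e [] | inj₂ rpa = inj₂ ((e , rpa) ∷ [])
    Edge-∷-Chain {a} e (_∷_ {w = q} (e′ , rpq) chain) | inj₂ rpa with a ≟ᶠ q
    ... | yes refl = inj₁ chain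
    ... | no a≢q   = Edge-∷-Chain (R-closed e e′ a≢q rpa rpq) chain

    Chain⇒Edge : ∀ {x y z} → Chain R z y → Edge G x y → R x z → Edge G z x
    Chain⇒Edge []               exy rxz = Edge-sym exy
    Chain⇒Edge ((e , rzw) ∷ chain) exy rxz =
      R-closed˘ e (Chain⇒Edge chain exy (R-trans rxz rzw)) (λ { refl → R-asym rxz rxz }) rzw (R-trans rxz rzw)

-- Bad vertices along a walk

module IntervalCount {n} (G : Graph n) (ℓ : Fin n → ℕ) (ℓ-injective : ∀ {a b} → ℓ a ≡ ℓ b → a ≡ b)
  (bad : Fin n → Bool) (bad-avoids-edges : ∀ {a c w} → Edge G a c → ℓ a < ℓ w → ℓ w < ℓ c → bad w ≡ false)
  where

  open ℕₚ.≤-Reasoning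

  inInterval : ℕ → ℕ → ℕ → ℕ
  inInterval x y z = 𝟙 (does (x <? y ×-dec y ≤? z))

  inInterval-split : ∀ x y z c → inInterval x y z ≤ₙ inInterval c y z + inInterval x y c
  inInterval-split x y z c with ℕₚ.<-≤-connex c y
  ... | inj₁ c<y = ℕₚ.≤-trans (𝟙-does-mono (x <? y ×-dec y ≤? z) (c <? y ×-dec y ≤? z) λ (_ , y≤z) → c<y , y≤z)
                              (ℕₚ.m≤m+n _ _)
  ... | inj₂ y≤c = ℕₚ.≤-trans (𝟙-does-mono (x <? y ×-dec y ≤? z) (x <? y ×-dec y ≤? c) λ (x<y , _) → x<y , y≤c)
                              (ℕₚ.m≤n+m _ _)

  inInterval-empty : ∀ x y → inInterval x y x ≡ 0
  inInterval-empty x y = cong 𝟙 (dec-false (x <? y ×-dec y ≤? x) λ (x<y , y≤x) → ℕₚ.<-irrefl refl (ℕₚ.<-≤-trans x<y y≤x))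

  badAt : Fin n → Fin n → Fin n → ℕ
  badAt a b w = 𝟙 (bad w) * inInterval (ℓ a) (ℓ w) (ℓ b)

  badIn : Fin n → Fin n → ℕ
  badIn a b = sum (badAt a b)

  badAt-Edge : ∀ {a c} → Edge G a c → ∀ w → badAt a c w ≤ₙ 𝟙 (does (w ≟ᶠ c))
  badAt-Edge {a} {c} e w with <-cmp (ℓ w) (ℓ c)
  ... | tri≈ _ ℓw≡ℓc _ rewrite ℓ-injective ℓw≡ℓc | dec-true (c ≟ᶠ c) refl = 𝟙*𝟙≤1 (bad c) _
  ... | tri> _ _ c<w rewrite dec-false (ℓ a <? ℓ w ×-dec ℓ w ≤? ℓ c) (λ (_ , w≤c) → ℕₚ.<⇒≱ c<w w≤c)
                          | ℕₚ.*-zeroʳ (𝟙 (bad w)) = z≤n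
  ... | tri< w<c _ _ with ℓ a <? ℓ w
  ...   | yes a<w rewrite bad-avoids-edges e a<w w<c = z≤n
  ...   | no a≮w rewrite dec-false (ℓ a <? ℓ w ×-dec ℓ w ≤? ℓ c) (a≮w ∘ proj₁)
                       | ℕₚ.*-zeroʳ (𝟙 (bad w)) = z≤n

  badIn≤length : ∀ {a b k} → Walk G a b k → badIn a b ≤ₙ k
  badIn≤length {a} (here _) = ℕₚ.≤-reflexive (begin-equality
    badIn a a          ≡⟨ sum-cong-≗ (λ w → cong (𝟙 (bad w) *_) (inInterval-empty (ℓ a) (ℓ w))) ⟩
    sum (λ w → 𝟙 (bad w) * 0)  ≡⟨ sum-cong-≗ (λ w → ℕₚ.*-zeroʳ (𝟙 (bad w))) ⟩
    sum {n} (λ _ → 0)  ≡⟨ sum-replicate-zero n ⟩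
    0                  ∎)
  badIn≤length {a} {b} {suc k} (step {w = c} e walk) = begin
    badIn a b
      ≤⟨ sum-mono-≤ (λ w → ℕₚ.*-monoʳ-≤ (𝟙 (bad w)) (inInterval-split (ℓ a) (ℓ w) (ℓ b) (ℓ c))) ⟩
    sum (λ w → 𝟙 (bad w) * (inInterval (ℓ c) (ℓ w) (ℓ b) + inInterval (ℓ a) (ℓ w) (ℓ c)))
      ≡⟨ sum-cong-≗ (λ w → ℕₚ.*-distribˡ-+ (𝟙 (bad w)) _ _) ⟩
    sum (λ w → badAt c b w + badAt a c w)
      ≡⟨ ∑-distrib-+ (badAt c b) (badAt a c) ⟩
    badIn c b + badIn a c
      ≤⟨ ℕₚ.+-mono-≤ (badIn≤length walk) (sum-mono-≤ (badAt-Edge e)) ⟩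
    k + sum (λ w → 𝟙 (does (w ≟ᶠ c)))
      ≡⟨ cong (k +_) (sum-𝟙-≟ c) ⟩
    k + 1
      ≡⟨ ℕₚ.+-comm k 1 ⟩
    suc k ∎

  bad-count≤1+length : ∀ {a₀ a₁ k} → (∀ w → ℓ a₀ ≤ₙ ℓ w) → (∀ w → ℓ w ≤ₙ ℓ a₁) → Walk G a₀ a₁ k →
               sum (𝟙 ∘ bad) ≤ₙ 1 + k
  bad-count≤1+length {a₀} {a₁} {k} a₀-min a₁-max walk = begin
    sum (𝟙 ∘ bad)                                              ≤⟨ sum-mono-≤ split ⟩
    sum (λ w → 𝟙 (does (w ≟ᶠ a₀)) + badAt a₀ a₁ w)             ≡⟨ ∑-distrib-+ (λ w → 𝟙 (does (w ≟ᶠ a₀))) (badAt a₀ a₁) ⟩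
    sum (λ w → 𝟙 (does (w ≟ᶠ a₀))) + badIn a₀ a₁              ≤⟨ ℕₚ.+-mono-≤ (ℕₚ.≤-reflexive (sum-𝟙-≟ a₀)) (badIn≤length walk) ⟩
    1 + k                                                      ∎
    where
    a₀<w : ∀ {w} → w ≢ a₀ → ℓ a₀ < ℓ w
    a₀<w {w} w≢a₀ = ℕₚ.≤∧≢⇒< (a₀-min w) (λ ℓa₀≡ℓw → w≢a₀ (sym (ℓ-injective ℓa₀≡ℓw)))
    split : ∀ w → 𝟙 (bad w) ≤ₙ 𝟙 (does (w ≟ᶠ a₀)) + badAt a₀ a₁ w
    split w with w ≟ᶠ a₀
    ... | yes refl = ℕₚ.≤-trans (𝟙≤1 (bad w)) (ℕₚ.m≤m+n 1 _)
    ... | no w≢a₀ rewrite dec-true (ℓ a₀ <? ℓ w ×-dec ℓ w ≤? ℓ a₁) (a₀<w w≢a₀ , a₁-max w) =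
      ℕₚ.≤-reflexive (sym (ℕₚ.*-identityʳ _))

labelling-extremes : ∀ {m} (L : Fin (suc m) → Fin (suc m)) → Surjective _≡_ _≡_ L →
  ∃₂ λ a₀ a₁ → (∀ w → toℕ (L a₀) ≤ₙ toℕ (L w)) × (∀ w → toℕ (L w) ≤ₙ toℕ (L a₁))
labelling-extremes {m} L L-surjective = a₀ , a₁ , a₀-min , a₁-max
  where
  a₀ a₁ : Fin (suc m)
  a₀ = proj₁ (L-surjective fzero)
  a₁ = proj₁ (L-surjective (fromℕ m))
  a₀-min : ∀ w → toℕ (L a₀) ≤ₙ toℕ (L w)
  a₀-min w rewrite proj₂ (L-surjective fzero) refl = z≤n
  a₁-max : ∀ w → toℕ (L w) ≤ₙ toℕ (L a₁)
  a₁-max w rewrite proj₂ (L-surjective (fromℕ m)) refl | toℕ-fromℕ m = toℕ≤pred[n] (L w)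

module ClosedLabelling {n} (G : Graph n) (L : Fin n → Fin n)
  (L-injective : Injective _≡_ _≡_ L) (closed : ClosedLabeling G L) where

  open Chains G
  open ℕₚ.≤-Reasoning

  ℓ : Fin n → ℕ
  ℓ v = toℕ (L v)

  ℓ-injective : ∀ {a b} → ℓ a ≡ ℓ b → a ≡ b
  ℓ-injective = L-injective ∘ toℕ-injective

  _≺_ : Fin n → Fin n → Set
  a ≺ b = ℓ a < ℓ b

  ≺-connex : ∀ {a b} → a ≢ b → a ≺ b ⊎ b ≺ a
  ≺-connex {a} {b} a≢b with <-cmp (ℓ a) (ℓ b)
  ... | tri< a≺b _ _  = inj₁ a≺b
  ... | tri≈ _ ℓa≡ℓb _ = contradiction (ℓ-injective ℓa≡ℓb) a≢b
  ... | tri> _ _ b≺a  = inj₂ b≺a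

  closed-below : ∀ {a p q} → Edge G a p → Edge G p q → a ≢ q → p ≺ a → p ≺ q → Edge G a q
  closed-below e e′ a≢q p≺a p≺q = closed _ _ _ e e′ a≢q (inj₁ (p≺a , p≺q))

  closed-above : ∀ {a p q} → Edge G a p → Edge G p q → a ≢ q → a ≺ p → q ≺ p → Edge G a q
  closed-above e e′ a≢q a≺p q≺p = closed _ _ _ e e′ a≢q (inj₂ (a≺p , q≺p))

  module Up = MonotoneChains _≺_ <-trans <-asym ≺-connex closed-below closed-above
  module Down = MonotoneChains (flip _≺_) (flip <-trans) <-asym (swap ∘ ≺-connex) closed-above closed-below

  Walk⇒Chain : ∀ {a b k} → Walk G a b k → Chain _≺_ a b ⊎ Chain (flip _≺_) a b
  Walk⇒Chain (here _)   = inj₁ []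
  Walk⇒Chain (step e w) with Walk⇒Chain w
  ... | inj₁ up   = Up.Edge-∷-Chain e up
  ... | inj₂ down = swap (Down.Edge-∷-Chain e down)

  straddled⇒adjacent : Connected G → ∀ {x y z} → Edge G x y → x ≺ z → z ≺ y → Edge G z x × Edge G z y
  straddled⇒adjacent connected {x} {y} {z} exy x≺z z≺y = Edge-zx , Edge-zy
    where
    Edge-zx : Edge G z x
    Edge-zx with Walk⇒Chain (proj₂ (connected z y))
    ... | inj₁ up   = Up.Chain⇒Edge up exy x≺z
    ... | inj₂ down = contradiction z≺y (Down.¬Chain-against down)
    Edge-zy : Edge G z y
    Edge-zy with Walk⇒Chain (proj₂ (connected z x))
    ... | inj₁ up   = contradiction x≺z (Up.¬Chain-against up)
    ... | inj₂ down = Down.Chain⇒Edge down (Edge-sym exy) z≺y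

  module Neighbourhood (v : Fin n) where

    upper lower : Fin n → Bool
    upper a = adj G v a ∧ does (ℓ v <? ℓ a)
    lower a = adj G v a ∧ does (ℓ a <? ℓ v)

    u d : Fin n → ℕ
    u = 𝟙 ∘ upper
    d = 𝟙 ∘ lower

    e : Fin n → Fin n → ℕ
    e a b = 𝟙 (adj G a b)

    uu dd ud mixedLinked : Fin n → Fin n → ℕ
    uu a b = u a * u b
    dd a b = d a * d b
    ud a b = u a * d b + d a * u b
    mixedLinked a b = u a * d b * e a b

    A B U D X M : ℕ
    A = sum u
    B = sum d
    U = ∑< uu
    D = ∑< dd
    X = ∑< ud
    M = ∑< (λ a b → mixedLinked a b + mixedLinked b a)

    𝟙-adj≡u+d : ∀ a → 𝟙 (adj G v a) ≡ u a + d a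
    𝟙-adj≡u+d a with adj G v a in va | <-cmp (ℓ v) (ℓ a)
    ... | false | _ = refl
    ... | true | tri< v<a _ a≮v rewrite dec-true (ℓ v <? ℓ a) v<a | dec-false (ℓ a <? ℓ v) a≮v = refl
    ... | true | tri≈ _ ℓv≡ℓa _ = contradiction (ℓ-injective ℓv≡ℓa) (Edge⇒≢ va)
    ... | true | tri> v≮a _ a<v rewrite dec-false (ℓ v <? ℓ a) v≮a | dec-true (ℓ a <? ℓ v) a<v = refl

    u*d≡0 : ∀ a → u a * d a ≡ 0
    u*d≡0 a with adj G v a | <-cmp (ℓ v) (ℓ a)
    ... | false | _ = refl
    ... | true | tri< _ _ a≮v rewrite dec-false (ℓ a <? ℓ v) a≮v = ℕₚ.*-zeroʳ (𝟙 (does (ℓ v <? ℓ a)))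
    ... | true | tri≈ v≮a _ a≮v rewrite dec-false (ℓ v <? ℓ a) v≮a = refl
    ... | true | tri> v≮a _ _ rewrite dec-false (ℓ v <? ℓ a) v≮a = refl

    degree≡A+B : degree G v ≡ A + B
    degree≡A+B = trans (count-tabulate (adj G v) id) (trans (sum-cong-≗ 𝟙-adj≡u+d) (∑-distrib-+ u d))

    neighbourPairs≡U+D+X : neighbourPairs G v ≡ U + D + X
    neighbourPairs≡U+D+X = begin-equality
      neighbourPairs G v                                                ≡⟨ count-unorderedPairs n _ ⟩
      ∑< (λ a b → 𝟙 (adj G v a ∧ adj G v b))                             ≡⟨ ∑<-cong split ⟩
      ∑< (λ a b → (u a * u b + d a * d b) + (u a * d b + d a * u b))    ≡⟨ ∑<-distrib-+ (λ a b → uu a b + dd a b) ud ⟩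
      ∑< (λ a b → u a * u b + d a * d b) + X                            ≡⟨ cong (_+ X) (∑<-distrib-+ uu dd) ⟩
      U + D + X                                                         ∎
      where
      expand : ∀ ua da ub db → (ua + da) * (ub + db) ≡ (ua * ub + da * db) + (ua * db + da * ub)
      expand = solve-∀
      split : ∀ a b → 𝟙 (adj G v a ∧ adj G v b) ≡ (u a * u b + d a * d b) + (u a * d b + d a * u b)
      split a b = trans (𝟙-∧ (adj G v a) (adj G v b))
                        (trans (cong₂ _*_ (𝟙-adj≡u+d a) (𝟙-adj≡u+d b)) (expand (u a) (d a) (u b) (d b)))

    upper-intro : ∀ {a} → Edge G v a → v ≺ a → upper a ≡ true
    upper-intro va v≺a = cong₂ _∧_ va (dec-true (ℓ v <? ℓ _) v≺a)

    lower-intro : ∀ {a} → Edge G v a → a ≺ v → lower a ≡ true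
    lower-intro va a≺v = cong₂ _∧_ va (dec-true (ℓ _ <? ℓ v) a≺v)

    upper-pair⇒Edge : ∀ {a b} → a ≢ b → upper a ≡ true → upper b ≡ true → Edge G a b
    upper-pair⇒Edge {a} {b} a≢b ua ub =
      closed-below (Edge-sym (∧-conicalˡ _ _ ua)) (∧-conicalˡ _ _ ub) a≢b
                   (does⇒ (ℓ v <? ℓ a) (∧-conicalʳ _ _ ua)) (does⇒ (ℓ v <? ℓ b) (∧-conicalʳ _ _ ub))

    lower-pair⇒Edge : ∀ {a b} → a ≢ b → lower a ≡ true → lower b ≡ true → Edge G a b
    lower-pair⇒Edge {a} {b} a≢b la lb =
      closed-above (Edge-sym (∧-conicalˡ _ _ la)) (∧-conicalˡ _ _ lb) a≢b
                   (does⇒ (ℓ a <? ℓ v) (∧-conicalʳ _ _ la)) (does⇒ (ℓ b <? ℓ v) (∧-conicalʳ _ _ lb))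

    U+D+M≤linked : U + D + M ≤ₙ linkedNeighbourPairs G v
    U+D+M≤linked = begin
      U + D + M                                                        ≡⟨ cong (_+ M) (∑<-distrib-+ uu dd) ⟨
      ∑< (λ a b → u a * u b + d a * d b) + M                           ≡⟨ ∑<-distrib-+ (λ a b → uu a b + dd a b) _ ⟨
      ∑< (λ a b → (u a * u b + d a * d b) + (mixedLinked a b + mixedLinked b a))
                                                                       ≤⟨ ∑<-mono-≤ pointwise ⟩
      ∑< (λ a b → 𝟙 (adj G v a ∧ adj G v b ∧ adj G a b))               ≡⟨ count-unorderedPairs n _ ⟨
      linkedNeighbourPairs G v                                         ∎
      where
      factor : ∀ ua da ub db e → (ua * ub * e + da * db * e) + (ua * db * e + ub * da * e) ≡ (ua + da) * ((ub + db) * e)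
      factor = solve-∀
      pointwise : ∀ {a b} → a ≢ b →
        (u a * u b + d a * d b) + (mixedLinked a b + mixedLinked b a) ≤ₙ 𝟙 (adj G v a ∧ adj G v b ∧ adj G a b)
      pointwise {a} {b} a≢b = begin
        (u a * u b + d a * d b) + (mixedLinked a b + mixedLinked b a)
          ≤⟨ ℕₚ.+-monoˡ-≤ _ (ℕₚ.+-mono-≤ (𝟙-pair-≤ (upper a) (upper b) (adj G a b) (upper-pair⇒Edge a≢b))
                                         (𝟙-pair-≤ (lower a) (lower b) (adj G a b) (lower-pair⇒Edge a≢b))) ⟩
        (u a * u b * e a b + d a * d b * e a b) + (mixedLinked a b + u b * d a * e b a)
          ≡⟨ cong (λ x → (u a * u b * e a b + d a * d b * e a b) + (mixedLinked a b + u b * d a * 𝟙 x)) (symm G b a) ⟩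
        (u a * u b * e a b + d a * d b * e a b) + (mixedLinked a b + u b * d a * e a b)
          ≡⟨ factor (u a) (d a) (u b) (d b) (e a b) ⟩
        (u a + d a) * ((u b + d b) * e a b)
          ≡⟨ cong₂ (λ x y → x * (y * e a b)) (𝟙-adj≡u+d a) (𝟙-adj≡u+d b) ⟨
        𝟙 (adj G v a) * (𝟙 (adj G v b) * e a b)
          ≡⟨ trans (𝟙-∧ (adj G v a) (adj G v b ∧ adj G a b)) (cong (𝟙 (adj G v a) *_) (𝟙-∧ (adj G v b) (adj G a b))) ⟨
        𝟙 (adj G v a ∧ adj G v b ∧ adj G a b) ∎

    module _ {x y} (vx : Edge G v x) (vy : Edge G v y) (x≺v : x ≺ v) (v≺y : v ≺ y) (xy : Edge G x y) where

      1≤A : 1 ≤ₙ A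
      1≤A = subst (_≤ₙ A) (cong 𝟙 (upper-intro vy v≺y)) (term≤sum u y)

      1≤B : 1 ≤ₙ B
      1≤B = subst (_≤ₙ B) (cong 𝟙 (lower-intro vx x≺v)) (term≤sum d x)

      1≤M : 1 ≤ₙ M
      1≤M = subst (_≤ₙ M) mixedLinked-yx≡1 (∑<-symmetrised-≥-entry mixedLinked diagonal≡0 y x)
        where
        mixedLinked-yx≡1 : mixedLinked y x ≡ 1
        mixedLinked-yx≡1 rewrite upper-intro vy v≺y | lower-intro vx x≺v | Edge-sym xy = refl
        diagonal≡0 : ∀ a → mixedLinked a a ≡ 0
        diagonal≡0 a = cong (_* e a a) (u*d≡0 a)

      2≤degree : 2 ≤ₙ degree G v
      2≤degree = subst (2 ≤ₙ_) (sym degree≡A+B) (ℕₚ.+-mono-≤ 1≤A 1≤B)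

      1≤neighbourPairs : 1 ≤ₙ neighbourPairs G v
      1≤neighbourPairs = begin
        1                   ≤⟨ ℕₚ.*-mono-≤ 1≤A 1≤B ⟩
        A * B               ≡⟨ ∑<-disjoint-product u d u*d≡0 ⟨
        X                   ≤⟨ ℕₚ.m≤n+m X (U + D) ⟩
        U + D + X           ≡⟨ neighbourPairs≡U+D+X ⟨
        neighbourPairs G v  ∎

      neighbourPairs≤3*linked : neighbourPairs G v ≤ₙ 3 * linkedNeighbourPairs G v
      neighbourPairs≤3*linked = begin
        neighbourPairs G v             ≡⟨ neighbourPairs≡U+D+X ⟩
        U + D + X                      ≡⟨ cong (U + D +_) (∑<-disjoint-product u d u*d≡0) ⟩
        U + D + A * B                  ≤⟨ pair-count-bound {A} {B} {U} {D} {M} 1≤A 1≤B 1≤M (∑<-𝟙-pairs upper) (∑<-𝟙-pairs lower) ⟩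
        3 * (U + D + M)                ≤⟨ ℕₚ.*-monoʳ-≤ 3 U+D+M≤linked ⟩
        3 * linkedNeighbourPairs G v   ∎

    neighbours-straddle⇒atLeastThird : ∀ {x y} → Edge G v x → Edge G v y → x ≺ v → v ≺ y → Edge G x y → atLeastThird G v ≡ true
    neighbours-straddle⇒atLeastThird vx vy x≺v v≺y xy =
      atLeastThird-intro G v (2≤degree vx vy x≺v v≺y xy) (1≤neighbourPairs vx vy x≺v v≺y xy)
                             (neighbourPairs≤3*linked vx vy x≺v v≺y xy)

  straddled⇒atLeastThird : Connected G → ∀ {a c w} → Edge G a c → a ≺ w → w ≺ c → atLeastThird G w ≡ true
  straddled⇒atLeastThird connected {a} {c} {w} ac a≺w w≺c =
    Neighbourhood.neighbours-straddle⇒atLeastThird _ wa wc a≺w w≺c ac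
    where
    wa : Edge G w a
    wa = proj₁ (straddled⇒adjacent connected ac a≺w w≺c)
    wc : Edge G w c
    wc = proj₂ (straddled⇒adjacent connected ac a≺w w≺c)

theorem6p3 : (n : ℕ) (G : Graph n) (h : ℕ) →
    1 < n → Connected G → IsClosed G → HasDiameter G h →
    wsBound n h ≤ CWS G
theorem6p3 zero    _ _ () _ _ _
theorem6p3 (suc m) G h _ connected (L , (L-injective , L-surjective) , closed) (dist≤h , _) =
  wsBound≤ m h #good _ n≤#good+h+1 (sumℚ-≥-third (localClustering G) (localClustering-nonNeg G) id)
  where
  open ClosedLabelling G L L-injective closed
  open IntervalCount G ℓ ℓ-injective (not ∘ atLeastThird G)
                     (λ ac a≺w w≺c → cong not (straddled⇒atLeastThird connected ac a≺w w≺c))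
  #good : ℕ
  #good = sum (𝟙 ∘ atLeastThird G)
  #bad≤1+h : sum (𝟙 ∘ not ∘ atLeastThird G) ≤ₙ 1 + h
  #bad≤1+h with labelling-extremes L L-surjective
  ... | a₀ , a₁ , a₀-min , a₁-max with dist≤h a₀ a₁
  ...   | k , k≤h , walk = ℕₚ.≤-trans (bad-count≤1+length a₀-min a₁-max walk) (s≤s k≤h)
  n≤#good+h+1 : suc m ≤ₙ #good + suc h
  n≤#good+h+1 = subst (_≤ₙ #good + suc h) (sum-𝟙+sum-𝟙-not (atLeastThird G)) (ℕₚ.+-monoʳ-≤ #good #bad≤1+h)
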